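{- Let $\mathcal{V}$ be a $\ast$-autonomous category (w.r.t. a dualizing object $0$) with an epi-mono factorization system. Let $\epsilon:A\otimes B\to 0$ be a dual pairing and $f: A\to B$ a morphism, and let $\tilde f: A\to B$ be its adjoint. Factor $f=m\circ e$ and $\tilde f=\tilde m\circ\tilde e$ with $e,\tilde e$ epi and $m,\tilde m$ mono, and let $\mathrm{Im}(f)$, $\mathrm{Im}(\tilde f)$ be the codomains of $e$, $\tilde e$. Then $(\mathrm{Im}(f),\mathrm{Im}(\tilde f))$ is a dual pair, i.e. there exists a dual pairing $\mathrm{Im}(f)\otimes\mathrm{Im}(\tilde f)\to 0$.
   Context: $\mathcal{V}$ is symmetric monoidal closed (strict) with symmetry $\sigma$, internal hom $[X,Z]$ right adjoint to $X\otimes-$, evaluation $ev_{X,Z}:X\otimes[X,Z]\to Z$, $X^*:=[X,0]$; $\ast$-autonomous means each $j_X:X\to X^{**}$ (transpose of $ev_{X,0}\circ\sigma_{X^*,X}$) is an isomorphism. A dual pairing is $\epsilon:A\otimes B\to 0$ such that for all $X$, $f\mapsto\epsilon\circ(A\otimes f)$ is a bijection $\hom(X,B)\to\hom(A\otimes X,0)$ and $g\mapsto\epsilon\circ(g\otimes B)$ is a bijection $\hom(X,A)\to\hom(X\otimes B,0)$. If $\epsilon:A\otimes B\to 0$ is a dual pairing, so is $\epsilon\circ\sigma_{B,A}:B\otimes A\to 0$. The adjoint of $f:A\to B$ (with respect to the pairings $(A,B,\epsilon)$ and $(B,A,\epsilon\circ\sigma_{B,A})$) is the unique $\tilde f:A\to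 B$ with $\epsilon\circ(A\otimes\tilde f)=\epsilon\circ(A\otimes f)\circ\sigma_{A,A}$. -}

module Defs where

open import Level using (Level; _⊔_) renaming (suc to lsuc)
open import Data.Product using (Σ; _×_; _,_)
open import Relation.Binary.PropositionalEquality using (_≡_)
open import Function.Definitions using (Bijective)

record Category (o h : Level) : Set (lsuc (o ⊔ h)) where
  infixr 9 _∘_
  infix 4 _⇒_
  field
    Obj  : Set o
    _⇒_  : Obj → Obj → Set h
    id   : ∀ {X} → X ⇒ X
    _∘_  : ∀ {X Y Z} → Y ⇒ Z → X ⇒ Y → X ⇒ Z
    identityˡ : ∀ {X Y} {f : X ⇒ Y} → id ∘ f ≡ f
    identityʳ : ∀ {X Y} {f : X ⇒ Y} → f ∘ id ≡ f
    assoc : ∀ {W X Y Z} {f : W ⇒ X} {g : X ⇒ Y} {k : Y ⇒ Z} →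
            (k ∘ g) ∘ f ≡ k ∘ (g ∘ f)

  IsIso : ∀ {X Y} → X ⇒ Y → Set h
  IsIso {X} {Y} f = Σ (Y ⇒ X) (λ g → (g ∘ f ≡ id) × (f ∘ g ≡ id))

  Epi : ∀ {X Y} → X ⇒ Y → Set (o ⊔ h)
  Epi {X} {Y} e = ∀ {Z} (g k : Y ⇒ Z) → g ∘ e ≡ k ∘ e → g ≡ k

  Mono : ∀ {X Y} → X ⇒ Y → Set (o ⊔ h)
  Mono {X} {Y} m = ∀ {Z} (g k : Z ⇒ X) → m ∘ g ≡ m ∘ k → g ≡ k

-- The (Epi, Mono) factorization system: every morphism factors as an epi
-- followed by a mono, and epis are orthogonal to monos (diagonal fill-in;
-- uniqueness of the diagonal is automatic since e is epi).
record EpiMonoFactorization {o h} (C : Category o h) : Set (o ⊔ h) where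
  open Category C
  field
    factor : ∀ {X Y} (f : X ⇒ Y) →
      Σ Obj (λ M → Σ (X ⇒ M) (λ e → Σ (M ⇒ Y) (λ m →
        Epi e × Mono m × (m ∘ e ≡ f))))
    diagonal : ∀ {A B C D} (e : A ⇒ B) (m : C ⇒ D) (u : A ⇒ C) (v : B ⇒ D) →
      Epi e → Mono m → m ∘ u ≡ v ∘ e →
      Σ (B ⇒ C) (λ d → (d ∘ e ≡ u) × (m ∘ d ≡ v))

record SymMonClosed (o h : Level) : Set (lsuc (o ⊔ h)) where
  field
    cat : Category o h
  open Category cat public
  infixr 10 _⊗₀_ _⊗₁_
  field
    _⊗₀_ : Obj → Obj → Obj
    _⊗₁_ : ∀ {X Y X' Y'} → X ⇒ X' → Y ⇒ Y' → (X ⊗₀ Y) ⇒ (X' ⊗₀ Y')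
    ⊗-id : ∀ {X Y} → id {X} ⊗₁ id {Y} ≡ id
    ⊗-∘  : ∀ {X Y Z X' Y' Z'} {f : X ⇒ Y} {g : Y ⇒ Z} {f' : X' ⇒ Y'} {g' : Y' ⇒ Z'} →
           (g ∘ f) ⊗₁ (g' ∘ f') ≡ (g ⊗₁ g') ∘ (f ⊗₁ f')
    I : Obj
    α⇒ : ∀ {X Y Z} → (X ⊗₀ Y) ⊗₀ Z ⇒ X ⊗₀ (Y ⊗₀ Z)
    α⇐ : ∀ {X Y Z} → X ⊗₀ (Y ⊗₀ Z) ⇒ (X ⊗₀ Y) ⊗₀ Z
    α-isoˡ : ∀ {X Y Z} → α⇐ {X} {Y} {Z} ∘ α⇒ ≡ id
    α-isoʳ : ∀ {X Y Z} → α⇒ {X} {Y} {Z} ∘ α⇐ ≡ id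
    α-natural : ∀ {X Y Z X' Y' Z'} {f : X ⇒ X'} {g : Y ⇒ Y'} {k : Z ⇒ Z'} →
      α⇒ ∘ ((f ⊗₁ g) ⊗₁ k) ≡ (f ⊗₁ (g ⊗₁ k)) ∘ α⇒
    lu⇒ : ∀ {X} → I ⊗₀ X ⇒ X
    lu⇐ : ∀ {X} → X ⇒ I ⊗₀ X
    lu-isoˡ : ∀ {X} → lu⇐ {X} ∘ lu⇒ ≡ id
    lu-isoʳ : ∀ {X} → lu⇒ {X} ∘ lu⇐ ≡ id
    lu-natural : ∀ {X Y} {f : X ⇒ Y} → lu⇒ ∘ (id ⊗₁ f) ≡ f ∘ lu⇒
    ru⇒ : ∀ {X} → X ⊗₀ I ⇒ X
    ru⇐ : ∀ {X} → X ⇒ X ⊗₀ I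
    ru-isoˡ : ∀ {X} → ru⇐ {X} ∘ ru⇒ ≡ id
    ru-isoʳ : ∀ {X} → ru⇒ {X} ∘ ru⇐ ≡ id
    ru-natural : ∀ {X Y} {f : X ⇒ Y} → ru⇒ ∘ (f ⊗₁ id) ≡ f ∘ ru⇒
    triangle : ∀ {X Y} → (id {X} ⊗₁ lu⇒ {Y}) ∘ α⇒ ≡ ru⇒ ⊗₁ id
    pentagon : ∀ {W X Y Z} →
      (id {W} ⊗₁ α⇒ {X} {Y} {Z}) ∘ α⇒ ∘ (α⇒ ⊗₁ id) ≡ α⇒ ∘ α⇒
    σ : ∀ {X Y} → X ⊗₀ Y ⇒ Y ⊗₀ X
    σ-natural : ∀ {X Y X' Y'} {f : X ⇒ X'} {g : Y ⇒ Y'} →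
      σ ∘ (f ⊗₁ g) ≡ (g ⊗₁ f) ∘ σ
    σ-involutive : ∀ {X Y} → σ {Y} {X} ∘ σ {X} {Y} ≡ id
    hexagon : ∀ {X Y Z} →
      α⇒ ∘ σ {X} {Y ⊗₀ Z} ∘ α⇒ ≡ (id ⊗₁ σ) ∘ α⇒ ∘ (σ ⊗₁ id)
    [_,_] : Obj → Obj → Obj
    ev  : ∀ {X Z} → X ⊗₀ [ X , Z ] ⇒ Z
    cur : ∀ {X Y Z} → X ⊗₀ Y ⇒ Z → Y ⇒ [ X , Z ]
    cur-β : ∀ {X Y Z} {g : X ⊗₀ Y ⇒ Z} → ev ∘ (id ⊗₁ cur g) ≡ g
    cur-unique : ∀ {X Y Z} {g : X ⊗₀ Y ⇒ Z} {k : Y ⇒ [ X , Z ]} →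
      ev ∘ (id ⊗₁ k) ≡ g → k ≡ cur g

record StarAutonomous (o h : Level) : Set (lsuc (o ⊔ h)) where
  field
    smc : SymMonClosed o h
  open SymMonClosed smc public
  field
    𝟘 : Obj

  _* : Obj → Obj
  X * = [ X , 𝟘 ]

  j : (X : Obj) → X ⇒ ((X *) *)
  j X = cur (ev {X} {𝟘} ∘ σ {X *} {X})

  field
    j-iso : ∀ X → IsIso (j X)

  DualPairing : ∀ {A B} → A ⊗₀ B ⇒ 𝟘 → Set (o ⊔ h)
  DualPairing {A} {B} ε =
    (∀ X → Bijective _≡_ _≡_ (λ (f : X ⇒ B) → ε ∘ (id {A} ⊗₁ f))) ×
    (∀ X → Bijective _≡_ _≡_ (λ (g : X ⇒ A) → ε ∘ (g ⊗₁ id {B})))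

  IsAdjointOf : ∀ {A B} → A ⊗₀ B ⇒ 𝟘 → A ⇒ B → A ⇒ B → Set h
  IsAdjointOf {A} ε f f̃ = ε ∘ (id {A} ⊗₁ f̃) ≡ (ε ∘ (id {A} ⊗₁ f)) ∘ σ {A} {A}

{-# OPTIONS --safe #-}
-- Let c = cur ε : B → A*, a mono since ε is a dual pairing. The adjoint condition says
-- that c ∘ f̃ is the transpose of c ∘ f = c ∘ m ∘ e, so c ∘ m̃ ∘ ẽ factors through the
-- mono eᵗ : Im(f)* → A*, and the diagonal fill-in of ẽ against eᵗ yields
-- d : Im(f̃) → Im(f)*. It is mono because eᵗ ∘ d = c ∘ m̃ is, and epi because
-- ẽᵗ ∘ dᵗ ∘ j = c ∘ m is mono; hence d is an isomorphism. Finally a pairing whose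
-- curry is invertible is a dual pairing: on the other side its curry becomes the
-- transpose of the first one followed by j, which is invertible too.
module Submission where

open import Defs
open import Level using (Level; _⊔_)
open import Data.Product using (Σ; _×_; _,_; proj₁; proj₂)
open import Function.Definitions using (Bijective)
open import Function.Consequences.Propositional using (strictlySurjective⇒surjective)
open import Relation.Binary.PropositionalEquality
  using (_≡_; refl; sym; trans; cong; cong₂; subst; module ≡-Reasoning)

module CategoryProperties {o h : Level} (C : Category o h) where
  open Category C

  cancelˡ : ∀ {X Y Z} {a : Y ⇒ Z} {b : Z ⇒ Y} → b ∘ a ≡ id → (x : X ⇒ Y) → b ∘ (a ∘ x) ≡ x
  cancelˡ ba x = trans (sym assoc) (trans (cong (_∘ x) ba) identityˡ)

  cancelʳ : ∀ {X Y Z} {a : X ⇒ Y} {b : Y ⇒ X} → a ∘ b ≡ id → (x : Y ⇒ Z) → (x ∘ a) ∘ b ≡ x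
  cancelʳ ab x = trans assoc (trans (cong (x ∘_) ab) identityʳ)

  iso-mono : ∀ {X Y} {a : X ⇒ Y} → IsIso a → Mono a
  iso-mono (b , ba , _) x y ax≡ay =
    trans (sym (cancelˡ ba x)) (trans (cong (b ∘_) ax≡ay) (cancelˡ ba y))

  iso-epi : ∀ {X Y} {a : X ⇒ Y} → IsIso a → Epi a
  iso-epi (b , _ , ab) x y xa≡ya =
    trans (sym (cancelʳ ab x)) (trans (cong (_∘ b) xa≡ya) (cancelʳ ab y))

  iso-inverse : ∀ {X Y} {a : X ⇒ Y} (i : IsIso a) → IsIso (proj₁ i)
  iso-inverse {a = a} (b , ba , ab) = a , ab , ba

  iso-∘ : ∀ {X Y Z} {a : Y ⇒ Z} {b : X ⇒ Y} → IsIso a → IsIso b → IsIso (a ∘ b)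
  iso-∘ {a = a} {b} (a⁻¹ , a⁻¹a , aa⁻¹) (b⁻¹ , b⁻¹b , bb⁻¹) =
    b⁻¹ ∘ a⁻¹ ,
    trans assoc (trans (cong (b⁻¹ ∘_) (cancelˡ a⁻¹a b)) b⁻¹b) ,
    trans (sym assoc) (trans (cong (_∘ a⁻¹) (cancelʳ bb⁻¹ a)) aa⁻¹)

  mono-∘ : ∀ {X Y Z} {a : Y ⇒ Z} {b : X ⇒ Y} → Mono a → Mono b → Mono (a ∘ b)
  mono-∘ {a = a} {b} ma mb x y p = mb x y (ma (b ∘ x) (b ∘ y) (trans (sym assoc) (trans p assoc)))

  mono-∘-cancel : ∀ {X Y Z} {a : Y ⇒ Z} {b : X ⇒ Y} → Mono (a ∘ b) → Mono b
  mono-∘-cancel {a = a} {b} mab x y p = mab x y (trans assoc (trans (cong (a ∘_) p) (sym assoc)))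

  mono-∘-iso-cancel : ∀ {X Y Z} {a : Y ⇒ Z} {i : X ⇒ Y} → IsIso i → Mono (a ∘ i) → Mono a
  mono-∘-iso-cancel {a = a} iso@(_ , _ , ii⁻¹) mai =
    subst Mono (cancelʳ ii⁻¹ a) (mono-∘ mai (iso-mono (iso-inverse iso)))

module EpiMonoFactorizationProperties {o h : Level} {C : Category o h} (F : EpiMonoFactorization C) where
  open Category C
  open EpiMonoFactorization F

  epi-mono⇒iso : ∀ {X Y} {d : X ⇒ Y} → Epi d → Mono d → IsIso d
  epi-mono⇒iso {d = d} d-epi d-mono = diagonal d d id id d-epi d-mono (trans identityʳ (sym identityˡ))

module SymMonClosedProperties {o h : Level} (V : SymMonClosed o h) where
  open SymMonClosed V
  open CategoryProperties cat
  open ≡-Reasoning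

  id⊗-∘ : ∀ {X Y Z W} {g : Y ⇒ Z} {k : X ⇒ Y} → id {W} ⊗₁ (g ∘ k) ≡ (id ⊗₁ g) ∘ (id ⊗₁ k)
  id⊗-∘ {g = g} {k} = trans (cong (_⊗₁ (g ∘ k)) (sym identityˡ)) ⊗-∘

  ∘-⊗id : ∀ {X Y Z W} {g : Y ⇒ Z} {k : X ⇒ Y} → (g ∘ k) ⊗₁ id {W} ≡ (g ⊗₁ id) ∘ (k ⊗₁ id)
  ∘-⊗id {g = g} {k} = trans (cong ((g ∘ k) ⊗₁_) (sym identityˡ)) ⊗-∘

  ⊗-interchange : ∀ {X Y X′ Y′} {f : X ⇒ X′} {g : Y ⇒ Y′} →
    (f ⊗₁ id) ∘ (id ⊗₁ g) ≡ (id ⊗₁ g) ∘ (f ⊗₁ id)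
  ⊗-interchange = trans (sym ⊗-∘) (trans (cong₂ _⊗₁_ (trans identityʳ (sym identityˡ))
                                                     (trans identityˡ (sym identityʳ))) ⊗-∘)

  σ-iso : ∀ {X Y} → IsIso (σ {X} {Y})
  σ-iso = σ , σ-involutive , σ-involutive

  ∘-σσ : ∀ {X Y Z} {t : X ⊗₀ Y ⇒ Z} → (t ∘ σ) ∘ σ ≡ t
  ∘-σσ {t = t} = cancelʳ σ-involutive t

  ∘-σ-natural : ∀ {X Y X′ Y′ Z} {t : X′ ⊗₀ Y′ ⇒ Z} {f : Y ⇒ Y′} {g : X ⇒ X′} →
    (t ∘ σ) ∘ (f ⊗₁ g) ≡ (t ∘ (g ⊗₁ f)) ∘ σ
  ∘-σ-natural {t = t} = trans assoc (trans (cong (t ∘_) σ-natural) (sym assoc))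

  uncur : ∀ {X Y Z} → Y ⇒ [ X , Z ] → X ⊗₀ Y ⇒ Z
  uncur k = ev ∘ (id ⊗₁ k)

  uncur-cur : ∀ {X Y Z} {g : X ⊗₀ Y ⇒ Z} → uncur (cur g) ≡ g
  uncur-cur = cur-β

  cur-uncur : ∀ {X Y Z} {k : Y ⇒ [ X , Z ]} → cur (uncur k) ≡ k
  cur-uncur = sym (cur-unique refl)

  cur-injective : ∀ {X Y Z} {g g′ : X ⊗₀ Y ⇒ Z} → cur g ≡ cur g′ → g ≡ g′
  cur-injective p = trans (sym uncur-cur) (trans (cong uncur p) uncur-cur)

  uncur-injective : ∀ {X Y Z} {k k′ : Y ⇒ [ X , Z ]} → uncur k ≡ uncur k′ → k ≡ k′
  uncur-injective p = trans (sym cur-uncur) (trans (cong cur p) cur-uncur)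

  cur-natural : ∀ {X Y Y′ Z} {g : X ⊗₀ Y ⇒ Z} {k : Y′ ⇒ Y} → cur g ∘ k ≡ cur (g ∘ (id ⊗₁ k))
  cur-natural {g = g} {k} = cur-unique (begin
    ev ∘ (id ⊗₁ (cur g ∘ k))       ≡⟨ cong (ev ∘_) id⊗-∘ ⟩
    ev ∘ (id ⊗₁ cur g) ∘ (id ⊗₁ k) ≡⟨ sym assoc ⟩
    uncur (cur g) ∘ (id ⊗₁ k)      ≡⟨ cong (_∘ (id ⊗₁ k)) uncur-cur ⟩
    g ∘ (id ⊗₁ k)                  ∎)

  id⊗-epi : ∀ {X Y W} {e : X ⇒ Y} → Epi e → Epi (id {W} ⊗₁ e)
  id⊗-epi e-epi p q r = cur-injective
    (e-epi (cur p) (cur q) (trans cur-natural (trans (cong cur r) (sym cur-natural))))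

  ⊗id-epi : ∀ {X Y W} {e : X ⇒ Y} → Epi e → Epi (e ⊗₁ id {W})
  ⊗id-epi e-epi p q r = iso-epi σ-iso p q (id⊗-epi e-epi (p ∘ σ) (q ∘ σ)
    (trans ∘-σ-natural (trans (cong (_∘ σ) r) (sym ∘-σ-natural))))

module StarAutonomousProperties {o h : Level} (V : StarAutonomous o h) where
  open StarAutonomous V
  open CategoryProperties cat
  open SymMonClosedProperties smc
  open ≡-Reasoning

  _ᵗ : ∀ {X Y} → X ⇒ Y → Y * ⇒ X *
  g ᵗ = cur (ev ∘ (g ⊗₁ id))

  ᵗ-∘-cur : ∀ {X Y Z} {g : X ⇒ Y} {k : Z ⇒ Y *} → g ᵗ ∘ k ≡ cur (uncur k ∘ (g ⊗₁ id))
  ᵗ-∘-cur {g = g} {k} = trans cur-natural (cong cur (begin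
    (ev ∘ (g ⊗₁ id)) ∘ (id ⊗₁ k) ≡⟨ assoc ⟩
    ev ∘ (g ⊗₁ id) ∘ (id ⊗₁ k)   ≡⟨ cong (ev ∘_) ⊗-interchange ⟩
    ev ∘ (id ⊗₁ k) ∘ (g ⊗₁ id)   ≡⟨ sym assoc ⟩
    uncur k ∘ (g ⊗₁ id)          ∎))

  ᵗ-id : ∀ {X} → id {X} ᵗ ≡ id
  ᵗ-id = cur-uncur

  ᵗ-∘ : ∀ {X Y Z} {p : Y ⇒ Z} {q : X ⇒ Y} → (p ∘ q) ᵗ ≡ q ᵗ ∘ p ᵗ
  ᵗ-∘ {p = p} {q} = sym (begin
    q ᵗ ∘ p ᵗ                         ≡⟨ ᵗ-∘-cur ⟩
    cur (uncur (p ᵗ) ∘ (q ⊗₁ id))     ≡⟨ cong (λ t → cur (t ∘ (q ⊗₁ id))) uncur-cur ⟩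
    cur ((ev ∘ (p ⊗₁ id)) ∘ (q ⊗₁ id)) ≡⟨ cong cur (trans assoc (cong (ev ∘_) (sym ∘-⊗id))) ⟩
    (p ∘ q) ᵗ                         ∎)

  ᵗ-iso : ∀ {X Y} {g : X ⇒ Y} → IsIso g → IsIso (g ᵗ)
  ᵗ-iso (g⁻¹ , g⁻¹g , gg⁻¹) =
    g⁻¹ ᵗ ,
    trans (sym ᵗ-∘) (trans (cong _ᵗ gg⁻¹) ᵗ-id) ,
    trans (sym ᵗ-∘) (trans (cong _ᵗ g⁻¹g) ᵗ-id)

  cur-∘σ : ∀ {X Y} (Q : X ⊗₀ Y ⇒ 𝟘) → (cur Q) ᵗ ∘ j X ≡ cur (Q ∘ σ)
  cur-∘σ {X} Q = begin
    (cur Q) ᵗ ∘ j X                   ≡⟨ ᵗ-∘-cur ⟩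
    cur (uncur (j X) ∘ (cur Q ⊗₁ id)) ≡⟨ cong (λ t → cur (t ∘ (cur Q ⊗₁ id))) uncur-cur ⟩
    cur ((ev ∘ σ) ∘ (cur Q ⊗₁ id))    ≡⟨ cong cur ∘-σ-natural ⟩
    cur (uncur (cur Q) ∘ σ)           ≡⟨ cong (λ t → cur (t ∘ σ)) uncur-cur ⟩
    cur (Q ∘ σ)                       ∎

  j-natural : ∀ {X Y} (p : X ⇒ Y) → (p ᵗ) ᵗ ∘ j X ≡ j Y ∘ p
  j-natural p = trans (cur-∘σ (ev ∘ (p ⊗₁ id)))
                      (sym (trans cur-natural (cong cur ∘-σ-natural)))

  ᵗ-injective : ∀ {X Y} {p q : X ⇒ Y} → p ᵗ ≡ q ᵗ → p ≡ q
  ᵗ-injective {X} {Y} {p} {q} r = iso-mono (j-iso Y) p q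
    (trans (sym (j-natural p)) (trans (cong (λ t → (t ᵗ) ∘ j X) r) (j-natural q)))

  epi⇒ᵗ-mono : ∀ {X Y} {e : X ⇒ Y} → Epi e → Mono (e ᵗ)
  epi⇒ᵗ-mono e-epi _ _ p = uncur-injective
    (⊗id-epi e-epi _ _ (cur-injective (trans (sym ᵗ-∘-cur) (trans p ᵗ-∘-cur))))

  ᵗ-mono⇒epi : ∀ {X Y} {d : X ⇒ Y} → Mono (d ᵗ) → Epi d
  ᵗ-mono⇒epi dᵗ-mono g k p = ᵗ-injective
    (dᵗ-mono (g ᵗ) (k ᵗ) (trans (sym ᵗ-∘) (trans (cong _ᵗ p) ᵗ-∘)))

  RightUniversal : ∀ {A B} → A ⊗₀ B ⇒ 𝟘 → Set (o ⊔ h)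
  RightUniversal {A} {B} ε = ∀ X → Bijective _≡_ _≡_ (λ (f : X ⇒ B) → ε ∘ (id {A} ⊗₁ f))

  LeftUniversal : ∀ {A B} → A ⊗₀ B ⇒ 𝟘 → Set (o ⊔ h)
  LeftUniversal {A} {B} ε = ∀ X → Bijective _≡_ _≡_ (λ (g : X ⇒ A) → ε ∘ (g ⊗₁ id {B}))

  rightUniversal⇒cur-mono : ∀ {A B} {ε : A ⊗₀ B ⇒ 𝟘} → RightUniversal ε → Mono (cur ε)
  rightUniversal⇒cur-mono universal _ _ p =
    proj₁ (universal _) (cur-injective (trans (sym cur-natural) (trans p cur-natural)))

  cur-iso⇒rightUniversal : ∀ {A B} {ε : A ⊗₀ B ⇒ 𝟘} → IsIso (cur ε) → RightUniversal ε
  cur-iso⇒rightUniversal {ε = ε} iso@(c⁻¹ , _ , cc⁻¹) X = injective , strictlySurjective⇒surjective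
    (λ y → c⁻¹ ∘ cur y , cur-injective (trans (sym cur-natural) (cancelˡ cc⁻¹ (cur y))))
    where
    injective : ∀ {f f′ : X ⇒ _} → ε ∘ (id ⊗₁ f) ≡ ε ∘ (id ⊗₁ f′) → f ≡ f′
    injective p = iso-mono iso _ _ (trans cur-natural (trans (cong cur p) (sym cur-natural)))

  σ-rightUniversal⇒leftUniversal : ∀ {A B} {ε : A ⊗₀ B ⇒ 𝟘} →
    RightUniversal (ε ∘ σ) → LeftUniversal ε
  σ-rightUniversal⇒leftUniversal {ε = ε} universal X =
    injective , strictlySurjective⇒surjective surjective
    where
    through-σ : (g : X ⇒ _) → ε ∘ (g ⊗₁ id) ≡ ((ε ∘ σ) ∘ (id ⊗₁ g)) ∘ σ
    through-σ g = sym (trans (cong (_∘ σ) ∘-σ-natural) ∘-σσ)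

    injective : ∀ {g g′ : X ⇒ _} → ε ∘ (g ⊗₁ id) ≡ ε ∘ (g′ ⊗₁ id) → g ≡ g′
    injective {g} {g′} p = proj₁ (universal X)
      (iso-epi σ-iso _ _ (trans (sym (through-σ g)) (trans p (through-σ g′))))

    surjective : ∀ y → Σ (X ⇒ _) (λ g → ε ∘ (g ⊗₁ id) ≡ y)
    surjective y with proj₂ (universal X) (y ∘ σ)
    ... | g , g↦yσ = g , trans (through-σ g) (trans (cong (_∘ σ) (g↦yσ refl)) ∘-σσ)

  cur-iso⇒dualPairing : ∀ {A B} {ε : A ⊗₀ B ⇒ 𝟘} → IsIso (cur ε) → DualPairing ε
  cur-iso⇒dualPairing {A} {ε = ε} iso =
    cur-iso⇒rightUniversal iso ,
    σ-rightUniversal⇒leftUniversal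
      (cur-iso⇒rightUniversal (subst IsIso (cur-∘σ ε) (iso-∘ (ᵗ-iso iso) (j-iso A))))

module ImagePairing
  {o h : Level} (V : StarAutonomous o h) (F : EpiMonoFactorization (StarAutonomous.cat V))
  where
  open StarAutonomous V
  open CategoryProperties cat
  open SymMonClosedProperties smc
  open StarAutonomousProperties V
  open EpiMonoFactorizationProperties F
  open EpiMonoFactorization F using (diagonal)
  open ≡-Reasoning

  module Comparison
    {A B : Obj} {ε : A ⊗₀ B ⇒ 𝟘} (ε-universal : RightUniversal ε)
    {f f̃ : A ⇒ B} (adjoint : IsAdjointOf ε f f̃)
    {Imf Imf̃ : Obj} {e : A ⇒ Imf} {m : Imf ⇒ B} {ẽ : A ⇒ Imf̃} {m̃ : Imf̃ ⇒ B}
    (e-epi : Epi e) (m-mono : Mono m) (me≡f : m ∘ e ≡ f)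
    (ẽ-epi : Epi ẽ) (m̃-mono : Mono m̃) (m̃ẽ≡f̃ : m̃ ∘ ẽ ≡ f̃)
    where

    c : B ⇒ A *
    c = cur ε

    Q : Imf ⊗₀ A ⇒ 𝟘
    Q = (ε ∘ (id ⊗₁ m)) ∘ σ

    eᵗ-cur-Q≡c-m̃-ẽ : e ᵗ ∘ cur Q ≡ (c ∘ m̃) ∘ ẽ
    eᵗ-cur-Q≡c-m̃-ẽ = begin
      e ᵗ ∘ cur Q                              ≡⟨ ᵗ-∘-cur ⟩
      cur (uncur (cur Q) ∘ (e ⊗₁ id))          ≡⟨ cong (λ t → cur (t ∘ (e ⊗₁ id))) uncur-cur ⟩
      cur (((ε ∘ (id ⊗₁ m)) ∘ σ) ∘ (e ⊗₁ id))  ≡⟨ cong cur ∘-σ-natural ⟩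
      cur (((ε ∘ (id ⊗₁ m)) ∘ (id ⊗₁ e)) ∘ σ)  ≡⟨ cong (λ t → cur (t ∘ σ)) (trans assoc (cong (ε ∘_) (sym id⊗-∘))) ⟩
      cur ((ε ∘ (id ⊗₁ (m ∘ e))) ∘ σ)          ≡⟨ cong (λ t → cur ((ε ∘ (id ⊗₁ t)) ∘ σ)) me≡f ⟩
      cur ((ε ∘ (id ⊗₁ f)) ∘ σ)                ≡⟨ cong cur (sym adjoint) ⟩
      cur (ε ∘ (id ⊗₁ f̃))                      ≡⟨ sym cur-natural ⟩
      c ∘ f̃                                    ≡⟨ cong (c ∘_) (sym m̃ẽ≡f̃) ⟩
      c ∘ (m̃ ∘ ẽ)                              ≡⟨ sym assoc ⟩
      (c ∘ m̃) ∘ ẽ                              ∎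

    filler : Σ (Imf̃ ⇒ Imf *) (λ d → (d ∘ ẽ ≡ cur Q) × (e ᵗ ∘ d ≡ c ∘ m̃))
    filler = diagonal ẽ (e ᵗ) (cur Q) (c ∘ m̃) ẽ-epi (epi⇒ᵗ-mono e-epi) eᵗ-cur-Q≡c-m̃-ẽ

    d : Imf̃ ⇒ Imf *
    d = proj₁ filler

    c-mono : Mono c
    c-mono = rightUniversal⇒cur-mono ε-universal

    d-mono : Mono d
    d-mono = mono-∘-cancel (subst Mono (sym (proj₂ (proj₂ filler))) (mono-∘ c-mono m̃-mono))

    ẽᵗ-dᵗ-j≡c-m : ẽ ᵗ ∘ (d ᵗ ∘ j Imf) ≡ c ∘ m
    ẽᵗ-dᵗ-j≡c-m = begin
      ẽ ᵗ ∘ (d ᵗ ∘ j Imf)     ≡⟨ sym assoc ⟩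
      (ẽ ᵗ ∘ d ᵗ) ∘ j Imf     ≡⟨ cong (_∘ j Imf) (sym ᵗ-∘) ⟩
      (d ∘ ẽ) ᵗ ∘ j Imf       ≡⟨ cong (λ t → t ᵗ ∘ j Imf) (proj₁ (proj₂ filler)) ⟩
      (cur Q) ᵗ ∘ j Imf       ≡⟨ cur-∘σ Q ⟩
      cur (Q ∘ σ)             ≡⟨ cong cur ∘-σσ ⟩
      cur (ε ∘ (id ⊗₁ m))     ≡⟨ sym cur-natural ⟩
      c ∘ m                   ∎

    d-epi : Epi d
    d-epi = ᵗ-mono⇒epi (mono-∘-iso-cancel (j-iso Imf)
      (mono-∘-cancel (subst Mono (sym ẽᵗ-dᵗ-j≡c-m) (mono-∘ c-mono m-mono))))

    d-iso : IsIso d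
    d-iso = epi-mono⇒iso d-epi d-mono

mainTheorem7 : ∀ {o h : Level} (V : StarAutonomous o h) →
    let open StarAutonomous V in
    EpiMonoFactorization cat →
    ∀ {A B : Obj} (ε : A ⊗₀ B ⇒ 𝟘) → DualPairing ε →
    (f f̃ : A ⇒ B) → IsAdjointOf ε f f̃ →
    (Imf Imf̃ : Obj) (e : A ⇒ Imf) (m : Imf ⇒ B) (ẽ : A ⇒ Imf̃) (m̃ : Imf̃ ⇒ B) →
    Epi e → Mono m → m ∘ e ≡ f →
    Epi ẽ → Mono m̃ → m̃ ∘ ẽ ≡ f̃ →
    Σ (Imf ⊗₀ Imf̃ ⇒ 𝟘) (λ ε' → DualPairing ε')
mainTheorem7 V F _ (ε-universal , _) _ _ adjoint _ _ _ _ _ _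
             e-epi m-mono me≡f ẽ-epi m̃-mono m̃ẽ≡f̃ =
  uncur d , cur-iso⇒dualPairing (subst IsIso (sym cur-uncur) d-iso)
  where
  open StarAutonomous V
  open SymMonClosedProperties smc
  open StarAutonomousProperties V
  open ImagePairing V F
  open Comparison ε-universal adjoint e-epi m-mono me≡f ẽ-epi m̃-mono m̃ẽ≡f̃
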